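{- Let $\mathrm{D}$ be either $\mathrm{D.LE}$ or an extension $\mathrm{D.LE}'$ of $\mathrm{D.LE}$ by analytic structural rules. For every sequent $x\Rightarrow y$: (1) if the set $\{[x']_{\Phi_\mathcal{F}}\mid x'\in(x\Rightarrow y)^\leftarrow_\mathcal{F}\}$ is finite, then $(\mathbb{F}^{x\Rightarrow y}_{\mathrm{D}})^+$ is finite; (2) if the set $\{[y']_{\Phi_\mathcal{G}}\mid y'\in(x\Rightarrow y)^\leftarrow_\mathcal{G}\}$ is finite, then $(\mathbb{F}^{x\Rightarrow y}_{\mathrm{D}})^+$ is finite.
   Context: LE-signature $\mathcal{L}=\mathcal{L}(\mathcal{F},\mathcal{G})$: disjoint sets of connectives, each $h$ with arity $n_h$ and order type $\varepsilon_h\in\{1,\partial\}^{n_h}$ ($1^\partial=\partial,\partial^\partial=1$). Formulas: $\varphi::=p\mid\bot\mid\top\mid\varphi\wedge\varphi\mid\varphi\vee\varphi\mid f(\bar\varphi)\mid g(\bar\varphi)$. $\bar a^i_b$: $\bar a$ with $i$-th entry replaced by $b$. Residual symbols $f^\sharp_i$, $g^\flat_i$; $\mathcal{F}^*$ = $\mathcal{F}$ plus $f^\sharp_i$ with $\varepsilon_f(i)=\partial$ plus $g^\flat_i$ with $\varepsilon_g(i)=1$; $\mathcal{G}^*$ = $\mathcal{G}$ plus $f^\sharp_i$ with $\varepsilon_f(i)=1$ plus $g^\flat_i$ with $\varepsilon_g(i)=\partial$; $\varepsilon_{f^\sharp_i}(i)=\varepsilon_f(i)$, for $j\ne i$ $\varepsilon_{f^\sharp_i}(j)=\varepsilon_f(j)^\partial$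 if $\varepsilon_f(i)=1$ and $=\varepsilon_f(j)$ otherwise (likewise $g^\flat_i$). Structures: sorts $\mathsf{Str}_\mathcal{F},\mathsf{Str}_\mathcal{G}$ containing all formulas, closed under $\mathsf{F}_h$ ($h\in\mathcal{F}^*$, into $\mathsf{Str}_\mathcal{F}$, argument $i$ in $\mathsf{Str}_\mathcal{F}$ if $\varepsilon_h(i)=1$, $\mathsf{Str}_\mathcal{G}$ if $\partial$) and $\mathsf{G}_h$ ($h\in\mathcal{G}^*$, dually). Sequents $x\Rightarrow y$, $x\in\mathsf{Str}_\mathcal{F}$, $y\in\mathsf{Str}_\mathcal{G}$. Rules of $\mathrm{D.LE}$: (Id) $p\Rightarrow p$; (Cut) $x\Rightarrow\varphi$, $\varphi\Rightarrow y$ / $x\Rightarrow y$; invertible display rules $\mathsf{F}_f(\bar x)\Rightarrow y$ iff $x_i\Rightarrow\mathsf{G}_{f^\sharp_i}(\bar x^i_y)$ ($\varepsilon_f(i)=1$), iff $\mathsf{F}_{f^\sharp_i}(\bar x^i_y)\Rightarrow x_i$ ($\varepsilon_f(i)=\partial$); $x\Rightarrow\mathsf{G}_g(\bar y)$ iff $\mathsf{F}_{g^\flat_i}(\bar y^i_x)\Rightarrow y_i$ ($\varepsilon_g(i)=1$), iff $y_i\Rightarrow\mathsf{G}_{g^\flat_i}(\bar y^i_x)$ ($\varepsilon_g(i)=\partial$); $\bot\Rightarrow y$; $x\Rightarrow\top$; $\varphi\Rightarrow y$ / $\varphi\wedge\psi\Rightarrow y$ and $\psi\wedge\varphi\Rightarrow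 y$; $x\Rightarrow\varphi$ / $x\Rightarrow\varphi\vee\psi$ and $x\Rightarrow\psi\vee\varphi$; $x\Rightarrow\varphi$, $x\Rightarrow\psi$ / $x\Rightarrow\varphi\wedge\psi$; $\varphi\Rightarrow y$, $\psi\Rightarrow y$ / $\varphi\vee\psi\Rightarrow y$; $\mathsf{F}_f(\bar\varphi)\Rightarrow y$ / $f(\bar\varphi)\Rightarrow y$; $x_i\Rightarrow\varphi_i$ ($\varepsilon_f(i)=1$), $\varphi_j\Rightarrow x_j$ ($\varepsilon_f(j)=\partial$) / $\mathsf{F}_f(\bar x)\Rightarrow f(\bar\varphi)$; $x\Rightarrow\mathsf{G}_g(\bar\psi)$ / $x\Rightarrow g(\bar\psi)$; $\psi_i\Rightarrow y_i$ ($\varepsilon_g(i)=1$), $y_j\Rightarrow\psi_j$ ($\varepsilon_g(j)=\partial$) / $g(\bar\psi)\Rightarrow\mathsf{G}_g(\bar y)$. Analytic structural rule: structural rule scheme satisfying Belnap's conditions C1–C7 for proper display calculi. $\vdash_{\mathrm{D}}$: derivability in $\mathrm{D}$. Polarity notation: $X^\uparrow=\{u:xNu\ \forall x\in X\}$, $Y^\downarrow=\{w:wNy\ \forall y\in Y\}$; stable sets $X=X^{\uparrow\downarrow}$; $W^\varepsilon=\prod_iW^{\varepsilon(i)}$ ($W^1=W$, $W^\partial=U$), $U^\varepsilon$ dually; $S^{(0)}[C_1,..,C_n]=\{a:(a,\bar b)\in S\ \forall b_j\in C_j\}$. $(x\Rightarrow y)^\leftarrow$: smallest set of sequents containing $x\Rightarrow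 y$ and all premises of any rule instance of $\mathrm{D}$ whose conclusion is in it. $(x\Rightarrow y)^\leftarrow_\mathcal{F}=\{x'\mid x'\Rightarrow y'\in(x\Rightarrow y)^\leftarrow\text{ for some }y'\}$, $(x\Rightarrow y)^\leftarrow_\mathcal{G}=\{y'\mid x'\Rightarrow y'\in(x\Rightarrow y)^\leftarrow\text{ for some }x'\}$. $\Phi_\mathcal{F}$ is the equivalence relation on $\mathsf{Str}_\mathcal{F}$ with $(x,x')\in\Phi_\mathcal{F}$ iff the rules $x\Rightarrow Y$ / $x'\Rightarrow Y$ and $x'\Rightarrow Y$ / $x\Rightarrow Y$ (with $Y$ a metavariable over $\mathsf{Str}_\mathcal{G}$) are derivable in $\mathrm{D}$; $\Phi_\mathcal{G}$ on $\mathsf{Str}_\mathcal{G}$ analogously (with a metavariable $X$ over $\mathsf{Str}_\mathcal{F}$ on the left); $[\cdot]$ denotes equivalence classes. $\mathbb{F}^{x\Rightarrow y}_{\mathrm{D}}=(W,U,N,\{R_f\},\{R_g\})$ with $W=\mathsf{Str}_\mathcal{F}$, $U=\mathsf{Str}_\mathcal{G}$, $wNu$ iff $\vdash_{\mathrm{D}}w\Rightarrow u$ or $w\Rightarrow u\notin(x\Rightarrow y)^\leftarrow$, $R_f(u,\bar x)$ iff $\mathsf{F}_f(\bar x)Nu$, $R_g(w,\bar y)$ iff $wN\mathsf{G}_g(\bar y)$. Its complex algebra $(\cdot)^+$ has carrier the set of stable subsets of $W$, with $f(\bar X)=(R_f^{(0)}[\bar X'])^\downarrow$ ($X'_i=X_i$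 if $\varepsilon_f(i)=1$, $X_i^\uparrow$ if $\partial$) and $g(\bar X)=R_g^{(0)}[\bar X']$ ($X'_i=X_i^\uparrow$ if $\varepsilon_g(i)=1$, $X_i$ if $\partial$). -}

module Defs where

open import Data.Nat using (ℕ)
open import Data.Fin using (Fin)
open import Data.Fin.Properties using (_≟_)
open import Data.List using (List; []; _∷_; tabulate; map)
open import Data.List.Relation.Unary.All using (All)
open import Data.List.Relation.Unary.Any using (Any)
open import Data.List.Membership.Propositional using (_∈_)
open import Data.Product using (Σ; ∃; _×_; _,_)
open import Data.Sum using (_⊎_)
open import Data.Empty using (⊥)
open import Relation.Nullary using (¬_; yes; no)
open import Relation.Binary.PropositionalEquality using (_≡_; refl; subst; cong)

data Pol : Set where
  one : Pol
  ∂   : Pol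

_ᵖ : Pol → Pol
one ᵖ = ∂
∂ ᵖ   = one

record Signature : Set₁ where
  field
    F   : Set
    G   : Set
    arF : F → ℕ
    εF  : (f : F) → Fin (arF f) → Pol
    arG : G → ℕ
    εG  : (g : G) → Fin (arG g) → Pol

-- order type of the residual h^♯_i / h^♭_i of a connective with order type ε
-- (entry i kept, other entries dualised iff ε(i) = 1)
flipIf : Pol → Pol → Pol
flipIf one p = p ᵖ
flipIf ∂   p = p

resid : {n : ℕ} → (Fin n → Pol) → Fin n → Fin n → Pol
resid ε i j with j ≟ i
... | yes _ = ε i
... | no  _ = flipIf (ε i) (ε j)

data Sort : Set where
  𝔽 𝔾 : Sort

-- sort of the i-th argument of a structural connective from F* / G*
sF : Pol → Sort
sF one = 𝔽
sF ∂   = 𝔾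

sG : Pol → Sort
sG one = 𝔾
sG ∂   = 𝔽

module LE (Sg : Signature) (At : Set) where
  open Signature Sg

  data Fm : Set where
    var  : At → Fm
    ⊥ᶠ   : Fm
    ⊤ᶠ   : Fm
    _∧_  : Fm → Fm → Fm
    _∨_  : Fm → Fm → Fm
    fapp : (f : F) → (Fin (arF f) → Fm) → Fm
    gapp : (g : G) → (Fin (arG g) → Fm) → Fm

  data F* : Set where
    base : F → F*
    f♯   : (f : F) (i : Fin (arF f)) → εF f i ≡ ∂ → F*
    g♭   : (g : G) (i : Fin (arG g)) → εG g i ≡ one → F*

  data G* : Set where
    base : G → G*
    f♯   : (f : F) (i : Fin (arF f)) → εF f i ≡ one → G*
    g♭   : (g : G) (i : Fin (arG g)) → εG g i ≡ ∂ → G*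

  arF* : F* → ℕ
  arF* (base f)    = arF f
  arF* (f♯ f i _)  = arF f
  arF* (g♭ g i _)  = arG g

  εF* : (h : F*) → Fin (arF* h) → Pol
  εF* (base f)    = εF f
  εF* (f♯ f i _)  = resid (εF f) i
  εF* (g♭ g i _)  = resid (εG g) i

  arG* : G* → ℕ
  arG* (base g)    = arG g
  arG* (f♯ f i _)  = arF f
  arG* (g♭ g i _)  = arG g

  εG* : (h : G*) → Fin (arG* h) → Pol
  εG* (base g)    = εG g
  εG* (f♯ f i _)  = resid (εF f) i
  εG* (g♭ g i _)  = resid (εG g) i

  data Str : Sort → Set where
    fm : {s : Sort} → Fm → Str s
    SF : (h : F*) → ((i : Fin (arF* h)) → Str (sF (εF* h i))) → Str 𝔽
    SG : (h : G*) → ((i : Fin (arG* h)) → Str (sG (εG* h i))) → Str 𝔾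

  cast : {s t : Sort} → s ≡ t → Str s → Str t
  cast e x = subst Str e x

  record Seq : Set where
    constructor _⇒_
    field
      ante : Str 𝔽
      succ : Str 𝔾

  upd : {n : ℕ} (S T : Fin n → Sort) (i : Fin n)
        → ((j : Fin n) → ¬ (j ≡ i) → S j ≡ T j)
        → ((j : Fin n) → Str (S j)) → Str (T i)
        → (j : Fin n) → Str (T j)
  upd S T i eq xs z j with j ≟ i
  ... | yes refl = z
  ... | no  ne   = cast (eq j ne) (xs j)

  -- sort bookkeeping lemmas needed to build x̄^i_y
  sF-ᵖ : (p : Pol) → sF (p ᵖ) ≡ sG p
  sF-ᵖ one = refl
  sF-ᵖ ∂   = refl

  sG-ᵖ : (p : Pol) → sG (p ᵖ) ≡ sF p
  sG-ᵖ one = refl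
  sG-ᵖ ∂   = refl

  sym' : {A : Set} {a b : A} → a ≡ b → b ≡ a
  sym' refl = refl

  trans' : {A : Set} {a b c : A} → a ≡ b → b ≡ c → a ≡ c
  trans' refl q = q

  resid-i : {n : ℕ} (ε : Fin n → Pol) (i : Fin n) → resid ε i i ≡ ε i
  resid-i ε i with i ≟ i
  ... | yes _ = refl
  ... | no ne = Data.Empty.⊥-elim (ne refl)
    where import Data.Empty

  resid-j : {n : ℕ} (ε : Fin n → Pol) (i j : Fin n) → ¬ (j ≡ i)
            → resid ε i j ≡ flipIf (ε i) (ε j)
  resid-j ε i j ne with j ≟ i
  ... | yes e = Data.Empty.⊥-elim (ne e)
    where import Data.Empty
  ... | no _  = refl

  eqA : (f : F) (i : Fin (arF f)) (e : εF f i ≡ one) (j : Fin (arF f)) → ¬ (j ≡ i)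
        → sF (εF f j) ≡ sG (resid (εF f) i j)
  eqA f i e j ne rewrite resid-j (εF f) i j ne | e = sym' (sG-ᵖ (εF f j))

  eqB : (f : F) (i : Fin (arF f)) (e : εF f i ≡ ∂) (j : Fin (arF f)) → ¬ (j ≡ i)
        → sF (εF f j) ≡ sF (resid (εF f) i j)
  eqB f i e j ne rewrite resid-j (εF f) i j ne | e = refl

  eqC : (g : G) (i : Fin (arG g)) (e : εG g i ≡ one) (j : Fin (arG g)) → ¬ (j ≡ i)
        → sG (εG g j) ≡ sF (resid (εG g) i j)
  eqC g i e j ne rewrite resid-j (εG g) i j ne | e = sym' (sF-ᵖ (εG g j))

  eqD : (g : G) (i : Fin (arG g)) (e : εG g i ≡ ∂) (j : Fin (arG g)) → ¬ (j ≡ i)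
        → sG (εG g j) ≡ sG (resid (εG g) i j)
  eqD g i e j ne rewrite resid-j (εG g) i j ne | e = refl

  premF : (p : Pol) → Str (sF p) → Fm → Seq
  premF one x φ = x ⇒ fm φ
  premF ∂   y φ = fm φ ⇒ y

  premG : (p : Pol) → Str (sG p) → Fm → Seq
  premG one y ψ = fm ψ ⇒ y
  premG ∂   x ψ = x ⇒ fm ψ

  data LEInst : List Seq → Seq → Set where
    id   : (p : At) → LEInst [] (fm (var p) ⇒ fm (var p))
    cut  : (x : Str 𝔽) (φ : Fm) (y : Str 𝔾) → LEInst ((x ⇒ fm φ) ∷ (fm φ ⇒ y) ∷ []) (x ⇒ y)
    dispA→ : (f : F) (i : Fin (arF f)) (e : εF f i ≡ one)
             (xs : (j : Fin (arF f)) → Str (sF (εF f j))) (y : Str 𝔾) →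
             LEInst ((SF (base f) xs ⇒ y) ∷ [])
                    (cast (cong sF e) (xs i)
                       ⇒ SG (f♯ f i e)
                            (upd _ _ i (eqA f i e) xs
                                 (cast (sym' (trans' (cong sG (resid-i (εF f) i))
                                                     (cong sG e))) y)))
    dispA← : (f : F) (i : Fin (arF f)) (e : εF f i ≡ one)
             (xs : (j : Fin (arF f)) → Str (sF (εF f j))) (y : Str 𝔾) →
             LEInst ((cast (cong sF e) (xs i)
                       ⇒ SG (f♯ f i e)
                            (upd _ _ i (eqA f i e) xs
                                 (cast (sym' (trans' (cong sG (resid-i (εF f) i))
                                                     (cong sG e))) y))) ∷ [])
                    (SF (base f) xs ⇒ y)
    dispB→ : (f : F) (i : Fin (arF f)) (e : εF f i ≡ ∂)
             (xs : (j : Fin (arF f)) → Str (sF (εF f j))) (y : Str 𝔾) →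
             LEInst ((SF (base f) xs ⇒ y) ∷ [])
                    (SF (f♯ f i e)
                        (upd _ _ i (eqB f i e) xs
                             (cast (sym' (trans' (cong sF (resid-i (εF f) i))
                                                 (cong sF e))) y))
                       ⇒ cast (cong sF e) (xs i))
    dispB← : (f : F) (i : Fin (arF f)) (e : εF f i ≡ ∂)
             (xs : (j : Fin (arF f)) → Str (sF (εF f j))) (y : Str 𝔾) →
             LEInst ((SF (f♯ f i e)
                        (upd _ _ i (eqB f i e) xs
                             (cast (sym' (trans' (cong sF (resid-i (εF f) i))
                                                 (cong sF e))) y))
                       ⇒ cast (cong sF e) (xs i)) ∷ [])
                    (SF (base f) xs ⇒ y)
    dispC→ : (g : G) (i : Fin (arG g)) (e : εG g i ≡ one)
             (ys : (j : Fin (arG g)) → Str (sG (εG g j))) (x : Str 𝔽) →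
             LEInst ((x ⇒ SG (base g) ys) ∷ [])
                    (SF (g♭ g i e)
                        (upd _ _ i (eqC g i e) ys
                             (cast (sym' (trans' (cong sF (resid-i (εG g) i))
                                                 (cong sF e))) x))
                       ⇒ cast (cong sG e) (ys i))
    dispC← : (g : G) (i : Fin (arG g)) (e : εG g i ≡ one)
             (ys : (j : Fin (arG g)) → Str (sG (εG g j))) (x : Str 𝔽) →
             LEInst ((SF (g♭ g i e)
                        (upd _ _ i (eqC g i e) ys
                             (cast (sym' (trans' (cong sF (resid-i (εG g) i))
                                                 (cong sF e))) x))
                       ⇒ cast (cong sG e) (ys i)) ∷ [])
                    (x ⇒ SG (base g) ys)
    dispD→ : (g : G) (i : Fin (arG g)) (e : εG g i ≡ ∂)
             (ys : (j : Fin (arG g)) → Str (sG (εG g j))) (x : Str 𝔽) →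
             LEInst ((x ⇒ SG (base g) ys) ∷ [])
                    (cast (cong sG e) (ys i)
                       ⇒ SG (g♭ g i e)
                            (upd _ _ i (eqD g i e) ys
                                 (cast (sym' (trans' (cong sG (resid-i (εG g) i))
                                                     (cong sG e))) x)))
    dispD← : (g : G) (i : Fin (arG g)) (e : εG g i ≡ ∂)
             (ys : (j : Fin (arG g)) → Str (sG (εG g j))) (x : Str 𝔽) →
             LEInst ((cast (cong sG e) (ys i)
                       ⇒ SG (g♭ g i e)
                            (upd _ _ i (eqD g i e) ys
                                 (cast (sym' (trans' (cong sG (resid-i (εG g) i))
                                                     (cong sG e))) x))) ∷ [])
                    (x ⇒ SG (base g) ys)
    ⊥L   : (y : Str 𝔾) → LEInst [] (fm ⊥ᶠ ⇒ y)
    ⊤R   : (x : Str 𝔽) → LEInst [] (x ⇒ fm ⊤ᶠ)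
    ∧L₁  : (φ ψ : Fm) (y : Str 𝔾) → LEInst ((fm φ ⇒ y) ∷ []) (fm (φ ∧ ψ) ⇒ y)
    ∧L₂  : (φ ψ : Fm) (y : Str 𝔾) → LEInst ((fm φ ⇒ y) ∷ []) (fm (ψ ∧ φ) ⇒ y)
    ∨R₁  : (φ ψ : Fm) (x : Str 𝔽) → LEInst ((x ⇒ fm φ) ∷ []) (x ⇒ fm (φ ∨ ψ))
    ∨R₂  : (φ ψ : Fm) (x : Str 𝔽) → LEInst ((x ⇒ fm φ) ∷ []) (x ⇒ fm (ψ ∨ φ))
    ∧R   : (φ ψ : Fm) (x : Str 𝔽) → LEInst ((x ⇒ fm φ) ∷ (x ⇒ fm ψ) ∷ []) (x ⇒ fm (φ ∧ ψ))
    ∨L   : (φ ψ : Fm) (y : Str 𝔾) → LEInst ((fm φ ⇒ y) ∷ (fm ψ ⇒ y) ∷ []) (fm (φ ∨ ψ) ⇒ y)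
    fL   : (f : F) (φs : Fin (arF f) → Fm) (y : Str 𝔾) →
           LEInst ((SF (base f) (λ i → fm (φs i)) ⇒ y) ∷ []) (fm (fapp f φs) ⇒ y)
    fR   : (f : F) (φs : Fin (arF f) → Fm) (xs : (i : Fin (arF f)) → Str (sF (εF f i))) →
           LEInst (tabulate (λ i → premF (εF f i) (xs i) (φs i))) (SF (base f) xs ⇒ fm (fapp f φs))
    gR   : (g : G) (ψs : Fin (arG g) → Fm) (x : Str 𝔽) →
           LEInst ((x ⇒ SG (base g) (λ i → fm (ψs i))) ∷ []) (x ⇒ fm (gapp g ψs))
    gL   : (g : G) (ψs : Fin (arG g) → Fm) (ys : (i : Fin (arG g)) → Str (sG (εG g i))) →
           LEInst (tabulate (λ i → premG (εG g i) (ys i) (ψs i))) (fm (gapp g ψs) ⇒ SG (base g) ys)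

  data SStr : Sort → Set where
    mv  : {s : Sort} → ℕ → SStr s
    SFs : (h : F*) → ((i : Fin (arF* h)) → SStr (sF (εF* h i))) → SStr 𝔽
    SGs : (h : G*) → ((i : Fin (arG* h)) → SStr (sG (εG* h i))) → SStr 𝔾

  record SSeq : Set where
    constructor _⇛_
    field
      sante : SStr 𝔽
      ssucc : SStr 𝔾

  data Occ (s : Sort) (n : ℕ) : {t : Sort} → SStr t → Set where
    here : Occ s n (mv {s} n)
    inF  : (h : F*) (as : (i : Fin (arF* h)) → SStr (sF (εF* h i))) (i : Fin (arF* h))
           → Occ s n (as i) → Occ s n (SFs h as)
    inG  : (h : G*) (as : (i : Fin (arG* h)) → SStr (sG (εG* h i))) (i : Fin (arG* h))
           → Occ s n (as i) → Occ s n (SGs h as)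

  OccSeq : Sort → ℕ → SSeq → Set
  OccSeq s n (a ⇛ b) = Occ s n a ⊎ Occ s n b

  -- analytic structural rule: a structural rule scheme satisfying Belnap's
  -- conditions.  C2, C4 (sorts), C5 (no principal formulas), C6, C7 (instances
  -- = all substitutions) hold by construction; C1 amounts to every metavariable
  -- of a premise occurring in the conclusion; C3 to each metavariable occurring
  -- at most once in the conclusion.
  record AnalyticRule : Set where
    field
      premises   : List SSeq
      conclusion : SSeq
      C1 : (s : Sort) (n : ℕ) → Any (OccSeq s n) premises → OccSeq s n conclusion
      C3 : (s : Sort) (n : ℕ) (o o' : OccSeq s n conclusion) → o ≡ o'

  Subst : Set
  Subst = (s : Sort) → ℕ → Str s

  inst : {t : Sort} → Subst → SStr t → Str t
  inst σ (mv {s} n) = σ s n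
  inst σ (SFs h as) = SF h (λ i → inst σ (as i))
  inst σ (SGs h as) = SG h (λ i → inst σ (as i))

  instSeq : Subst → SSeq → Seq
  instSeq σ (a ⇛ b) = inst σ a ⇒ inst σ b

  record Calc : Set₁ where
    field
      Rules : Set
      rule  : Rules → AnalyticRule

  DLE : Calc
  DLE = record { Rules = ⊥ ; rule = λ () }

  module _ (D : Calc) where
    open Calc D

    data Inst : List Seq → Seq → Set where
      le  : {ps : List Seq} {c : Seq} → LEInst ps c → Inst ps c
      str : (r : Rules) (σ : Subst) →
            Inst (map (instSeq σ) (AnalyticRule.premises (rule r)))
                 (instSeq σ (AnalyticRule.conclusion (rule r)))

    data DerH (H : Seq → Set) : Seq → Set where
      hyp  : {s : Seq} → H s → DerH H s
      step : {ps : List Seq} {c : Seq} → Inst ps c → All (DerH H) ps → DerH H c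

    ⊢ : Seq → Set
    ⊢ = DerH (λ _ → ⊥)

    data Back (s₀ : Seq) : Seq → Set where
      base : Back s₀ s₀
      up   : {ps : List Seq} {c s : Seq} → Inst ps c → Back s₀ c → s ∈ ps → Back s₀ s

    BackF : Seq → Str 𝔽 → Set
    BackF s₀ x' = ∃ λ y' → Back s₀ (x' ⇒ y')

    BackG : Seq → Str 𝔾 → Set
    BackG s₀ y' = ∃ λ x' → Back s₀ (x' ⇒ y')

    ΦF : Str 𝔽 → Str 𝔽 → Set
    ΦF x x' = ((Y : Str 𝔾) → DerH (λ s → s ≡ (x ⇒ Y)) (x' ⇒ Y))
            × ((Y : Str 𝔾) → DerH (λ s → s ≡ (x' ⇒ Y)) (x ⇒ Y))

    ΦG : Str 𝔾 → Str 𝔾 → Set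
    ΦG y y' = ((X : Str 𝔽) → DerH (λ s → s ≡ (X ⇒ y)) (X ⇒ y'))
            × ((X : Str 𝔽) → DerH (λ s → s ≡ (X ⇒ y')) (X ⇒ y))

    -- the set {[x']_ΦF | x' ∈ (x ⇒ y)^←_F} is finite: it is the image of
    -- finitely many elements r 0, …, r (n-1) of (x ⇒ y)^←_F
    FinClassesF : Seq → Set
    FinClassesF s₀ = Σ ℕ λ n → Σ (Fin n → Str 𝔽) λ r →
                       ((k : Fin n) → BackF s₀ (r k))
                     × ((x' : Str 𝔽) → BackF s₀ x' → ∃ λ k → ΦF x' (r k))

    FinClassesG : Seq → Set
    FinClassesG s₀ = Σ ℕ λ n → Σ (Fin n → Str 𝔾) λ r →
                       ((k : Fin n) → BackG s₀ (r k))
                     × ((y' : Str 𝔾) → BackG s₀ y' → ∃ λ k → ΦG y' (r k))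

    record Frame : Set₁ where
      field
        W  : Set
        U  : Set
        N  : W → U → Set
        Rf : (f : F) → U → ((i : Fin (arF f)) → Str (sF (εF f i))) → Set
        Rg : (g : G) → W → ((i : Fin (arG g)) → Str (sG (εG g i))) → Set

    frame : Seq → Frame
    frame s₀ = record
      { W  = Str 𝔽
      ; U  = Str 𝔾
      ; N  = Nr
      ; Rf = λ f u xs → Nr (SF (base f) xs) u
      ; Rg = λ g w ys → Nr w (SG (base g) ys)
      }
      where
        Nr : Str 𝔽 → Str 𝔾 → Set
        Nr w u = ⊢ (w ⇒ u) ⊎ ¬ Back s₀ (w ⇒ u)

    -- complex algebra carrier: stable subsets of W
    module _ (s₀ : Seq) where
      open Frame (frame s₀)

      _↑ : (W → Set) → (U → Set)
      (X ↑) u = (x : W) → X x → N x u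

      _↓ : (U → Set) → (W → Set)
      (Y ↓) w = (y : U) → Y y → N w y

      _≐_ : (W → Set) → (W → Set) → Set
      X ≐ X' = (w : W) → (X w → X' w) × (X' w → X w)

      Stable : (W → Set) → Set
      Stable X = X ≐ ((X ↑) ↓)

      -- (𝔽^{x⇒y}_D)^+ is finite: its carrier (stable sets, up to extensional
      -- equality) is enumerated by finitely many stable sets
      FiniteComplexAlgebra : Set₁
      FiniteComplexAlgebra =
        Σ ℕ λ n → Σ (Fin n → (W → Set)) λ S →
          ((k : Fin n) → Stable (S k))
        × ((X : W → Set) → Stable X → ∃ λ k → X ≐ S k)

module Submission where

-- In any polarity (W, U, N), suppose points
-- r₀ … r_{n-1} of W cover the rows: every w ∈ W either is N-related to all of
-- U or has the same N-row as some r_k.  Then a stable set X is determined by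
-- the r_k it contains, X = {r_k | r_k ∈ X}↑↓, so classically there are at
-- most 2ⁿ stable sets.  Dually, points of U covering the columns give
-- X = {r_k | r_k ∈ X↑}↓.
--
-- A derivation
-- from hypotheses of a sequent in (x⇒y)^← is either closed or uses a
-- hypothesis inside (x⇒y)^←.  Hence a derivable rule t / s transports the
-- relation N of the canonical frame, so Φ-equivalent structures have equal
-- rows (columns), while structures outside the backward closure have full
-- rows (columns).  Finitely many Φ-classes therefore cover the rows (columns).

open import Defs
open import Axiom.ExcludedMiddle using (ExcludedMiddle)
open import Level using (0ℓ)
open import Data.Nat using (ℕ; _^_)
open import Data.Fin using (Fin; finToFun; funToFin)
open import Data.Fin.Properties using (finToFun-funToFin)
open import Data.Fin.Patterns using (0F; 1F)
open import Data.Product using (Σ; ∃; _×_; _,_; proj₁; proj₂)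
open import Data.Sum using (_⊎_; inj₁; inj₂)
open import Data.Empty using (⊥-elim)
open import Data.List using (List; []; _∷_)
open import Data.List.Relation.Unary.All using (All; []; _∷_)
open import Data.List.Relation.Unary.Any using (here; there)
open import Data.List.Membership.Propositional using (_∈_)
open import Function.Bundles using (_⇔_; mk⇔; Equivalence)
open import Relation.Nullary using (¬_; Dec; yes; no)
open import Relation.Binary.PropositionalEquality using (_≡_; refl)

open Equivalence using (to; from)

-- Subsets of Fin n are coded by their characteristic maps Fin n → Fin 2, and
-- these maps are enumerated by Fin (2 ^ n).
decode : {n : ℕ} → Fin (2 ^ n) → Fin n → Fin 2
decode {n} = finToFun {2} {n}

mark : {P : Set} → Dec P → Fin 2
mark (yes _) = 1F
mark (no _)  = 0F

mark≡1⇔ : {P : Set} (d : Dec P) → (mark d ≡ 1F) ⇔ P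
mark≡1⇔ (yes p) = mk⇔ (λ _ → p) (λ _ → refl)
mark≡1⇔ (no ¬p) = mk⇔ (λ ()) (λ p → ⊥-elim (¬p p))

Image : {A : Set} {n : ℕ} → (Fin n → A) → (Fin n → Set) → A → Set
Image r P a = ∃ λ k → P k × a ≡ r k

module Polarity {W U : Set} (N : W → U → Set) where

  _↑ : (W → Set) → (U → Set)
  (X ↑) u = (x : W) → X x → N x u

  _↓ : (U → Set) → (W → Set)
  (Y ↓) w = (y : U) → Y y → N w y

  _≐_ : (W → Set) → (W → Set) → Set
  X ≐ X' = (w : W) → (X w → X' w) × (X' w → X w)

  Stable : (W → Set) → Set
  Stable X = X ≐ ((X ↑) ↓)

  FinitelyManyStable : Set₁
  FinitelyManyStable =
    Σ ℕ λ n → Σ (Fin n → (W → Set)) λ S →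
      ((k : Fin n) → Stable (S k))
    × ((X : W → Set) → Stable X → ∃ λ k → X ≐ S k)

  -- Every Y↓ is stable, since Y ⊆ Y↓↑ and ↓ is antitone.
  ↓-stable : (Y : U → Set) → Stable (Y ↓)
  ↓-stable Y w = (λ wY u uX↑ → uX↑ w wY) , (λ w∈ y yY → w∈ y (λ x xY → xY y yY))

  finitely-many-stable : ExcludedMiddle 0ℓ → (n : ℕ) (S : (Fin n → Set) → (W → Set))
    → ((P : Fin n → Set) → Stable (S P))
    → ((X : W → Set) → Stable X → ∃ λ (Q : Fin n → Set) →
         (P : Fin n → Set) → ((k : Fin n) → P k ⇔ Q k) → X ≐ S P)
    → FinitelyManyStable
  finitely-many-stable lem n S stable determined =
    2 ^ n , (λ i → S (Selected i)) , (λ i → stable (Selected i)) , cover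
    where
      Selected : Fin (2 ^ n) → Fin n → Set
      Selected i k = decode i k ≡ 1F

      cover : (X : W → Set) → Stable X → ∃ λ i → X ≐ S (Selected i)
      cover X sX with determined X sX
      ... | Q , X≐S = funToFin code , X≐S (Selected (funToFin code)) selected⇔Q
        where
          code : Fin n → Fin 2
          code k = mark (lem {Q k})

          selected⇔Q : (k : Fin n) → Selected (funToFin code) k ⇔ Q k
          selected⇔Q k rewrite finToFun-funToFin code k = mark≡1⇔ (lem {Q k})

  FullRow : W → Set
  FullRow w = (u : U) → N w u

  SameRow : W → W → Set
  SameRow w w' = (u : U) → N w u ⇔ N w' u

  RowsCoveredBy : {n : ℕ} → (Fin n → W) → Set
  RowsCoveredBy r = (w : W) → FullRow w ⊎ ∃ λ k → SameRow w (r k)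

  determined-by-rows : {n : ℕ} {r : Fin n → W} → RowsCoveredBy r
    → {X : W → Set} → Stable X
    → (P : Fin n → Set) → ((k : Fin n) → P k ⇔ X (r k)) → X ≐ ((Image r P ↑) ↓)
  determined-by-rows {r = r} covered {X} sX P P⇔X w = into , (λ w∈ → proj₂ (sX w) (outof w∈))
    where
      into : X w → ((Image r P ↑) ↓) w
      into wX u u∈ with covered w
      ... | inj₁ full = full u
      ... | inj₂ (k , same) = from (same u) (u∈ (r k) (k , from (P⇔X k) rkX , refl))
        where
          rkX : X (r k)
          rkX = proj₂ (sX (r k)) (λ u' u'X↑ → to (same u') (proj₁ (sX w) wX u' u'X↑))

      outof : ((Image r P ↑) ↓) w → ((X ↑) ↓) w
      outof w∈ u uX↑ = w∈ u λ { _ (k , Pk , refl) → uX↑ (r k) (to (P⇔X k) Pk) }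

  rows-finite : ExcludedMiddle 0ℓ → {n : ℕ} (r : Fin n → W) → RowsCoveredBy r
    → FinitelyManyStable
  rows-finite lem {n} r covered =
    finitely-many-stable lem n (λ P → (Image r P ↑) ↓) (λ P → ↓-stable (Image r P ↑))
      (λ X sX → (λ k → X (r k)) , determined-by-rows covered sX)

  FullColumn : U → Set
  FullColumn u = (w : W) → N w u

  SameColumn : U → U → Set
  SameColumn u u' = (w : W) → N w u ⇔ N w u'

  ColumnsCoveredBy : {n : ℕ} → (Fin n → U) → Set
  ColumnsCoveredBy r = (u : U) → FullColumn u ⊎ ∃ λ k → SameColumn u (r k)

  determined-by-columns : {n : ℕ} {r : Fin n → U} → ColumnsCoveredBy r
    → {X : W → Set} → Stable X
    → (P : Fin n → Set) → ((k : Fin n) → P k ⇔ (X ↑) (r k)) → X ≐ (Image r P ↓)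
  determined-by-columns {r = r} covered {X} sX P P⇔X↑ w = into , (λ w∈ → proj₂ (sX w) (outof w∈))
    where
      into : X w → (Image r P ↓) w
      into wX _ (k , Pk , refl) = to (P⇔X↑ k) Pk w wX

      outof : (Image r P ↓) w → ((X ↑) ↓) w
      outof w∈ u uX↑ with covered u
      ... | inj₁ full = full w
      ... | inj₂ (k , same) = from (same w) (w∈ (r k) (k , from (P⇔X↑ k) rkX↑ , refl))
        where
          rkX↑ : (X ↑) (r k)
          rkX↑ x xX = to (same x) (uX↑ x xX)

  columns-finite : ExcludedMiddle 0ℓ → {n : ℕ} (r : Fin n → U) → ColumnsCoveredBy r
    → FinitelyManyStable
  columns-finite lem {n} r covered =
    finitely-many-stable lem n (λ P → Image r P ↓) (λ P → ↓-stable (Image r P))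
      (λ X sX → (λ k → (X ↑) (r k)) , determined-by-columns covered sX)

module Derivations (Sg : Signature) (At : Set) (D : LE.Calc Sg At) where
  open LE Sg At

  discharge : {H : Seq → Set} → (∀ {t} → H t → ⊢ D t) → ∀ {s} → DerH D H s → ⊢ D s
  discharge-all : {H : Seq → Set} → (∀ {t} → H t → ⊢ D t)
    → ∀ {ps} → All (DerH D H) ps → All (⊢ D) ps
  discharge hyps (hyp h)     = hyps h
  discharge hyps (step i ds) = step i (discharge-all hyps ds)
  discharge-all hyps []       = []
  discharge-all hyps (d ∷ ds) = discharge hyps d ∷ discharge-all hyps ds

  module _ (s₀ : Seq) where

    -- Premises of a rule whose conclusion lies in s₀^← lie in s₀^← again, so a
    -- derivation from H of a sequent in s₀^← is closed unless it uses a
    -- hypothesis lying in s₀^←.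
    HypothesisInClosure : (Seq → Set) → Set
    HypothesisInClosure H = ∃ λ t → H t × Back D s₀ t

    closed-or-uses-hypothesis : {H : Seq → Set} {s : Seq} → DerH D H s → Back D s₀ s
      → ⊢ D s ⊎ HypothesisInClosure H
    closed-or-uses-hypothesis-all : {H : Seq → Set} {ps : List Seq} → All (DerH D H) ps
      → (∀ {s} → s ∈ ps → Back D s₀ s) → All (⊢ D) ps ⊎ HypothesisInClosure H
    closed-or-uses-hypothesis (hyp h) b = inj₂ (_ , h , b)
    closed-or-uses-hypothesis (step i ds) b
      with closed-or-uses-hypothesis-all ds (up i b)
    ... | inj₁ closed = inj₁ (step i closed)
    ... | inj₂ used   = inj₂ used
    closed-or-uses-hypothesis-all [] _ = inj₁ []
    closed-or-uses-hypothesis-all (d ∷ ds) inBack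
      with closed-or-uses-hypothesis d (inBack (here refl))
         | closed-or-uses-hypothesis-all ds (λ m → inBack (there m))
    ... | inj₂ used | _          = inj₂ used
    ... | inj₁ _    | inj₂ used  = inj₂ used
    ... | inj₁ d'   | inj₁ ds'   = inj₁ (d' ∷ ds')

    -- The relation N of the canonical frame 𝔽^{s₀}_D, read on sequents.
    Holds : Seq → Set
    Holds s = ⊢ D s ⊎ ¬ Back D s₀ s

    holds-transfer : ExcludedMiddle 0ℓ → {s t : Seq} → DerH D (λ s' → s' ≡ t) s
      → Holds t → Holds s
    holds-transfer lem t/s (inj₁ ⊢t) = inj₁ (discharge (λ { refl → ⊢t }) t/s)
    holds-transfer lem {s} t/s (inj₂ t∉) with lem {Back D s₀ s}
    ... | no s∉ = inj₂ s∉
    ... | yes s∈ with closed-or-uses-hypothesis t/s s∈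
    ...   | inj₁ ⊢s             = inj₁ ⊢s
    ...   | inj₂ (_ , refl , t∈) = ⊥-elim (t∉ t∈)

module CanonicalFrame (lem : ExcludedMiddle 0ℓ) (Sg : Signature) (At : Set)
                      (D : LE.Calc Sg At) (s₀ : LE.Seq Sg At) where
  open LE Sg At
  open Derivations Sg At D using (holds-transfer)
  open Frame (frame D s₀) using (N)
  open Polarity N using (SameRow; RowsCoveredBy; rows-finite;
                         SameColumn; ColumnsCoveredBy; columns-finite)

  ΦF⇒same-row : {w w' : Str 𝔽} → ΦF D w w' → SameRow w w'
  ΦF⇒same-row (w/w' , w'/w) u =
    mk⇔ (holds-transfer s₀ lem (w/w' u)) (holds-transfer s₀ lem (w'/w u))

  ΦG⇒same-column : {u u' : Str 𝔾} → ΦG D u u' → SameColumn u u'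
  ΦG⇒same-column (u/u' , u'/u) w =
    mk⇔ (holds-transfer s₀ lem (u/u' w)) (holds-transfer s₀ lem (u'/u w))

  -- Representatives of the Φ_F-classes of s₀^←_F cover the rows: a structure
  -- outside s₀^←_F is N-related to everything.
  rows-covered : {n : ℕ} (r : Fin n → Str 𝔽)
    → ((w : Str 𝔽) → BackF D s₀ w → ∃ λ k → ΦF D w (r k)) → RowsCoveredBy r
  rows-covered r classes w with lem {BackF D s₀ w}
  ... | no w∉ = inj₁ (λ u → inj₂ (λ w⇒u∈ → w∉ (u , w⇒u∈)))
  ... | yes w∈ with classes w w∈
  ...   | k , w~rk = inj₂ (k , ΦF⇒same-row w~rk)

  columns-covered : {n : ℕ} (r : Fin n → Str 𝔾)
    → ((u : Str 𝔾) → BackG D s₀ u → ∃ λ k → ΦG D u (r k)) → ColumnsCoveredBy r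
  columns-covered r classes u with lem {BackG D s₀ u}
  ... | no u∉ = inj₁ (λ w → inj₂ (λ w⇒u∈ → u∉ (w , w⇒u∈)))
  ... | yes u∈ with classes u u∈
  ...   | k , u~rk = inj₂ (k , ΦG⇒same-column u~rk)

  finite-by-F : FinClassesF D s₀ → FiniteComplexAlgebra D s₀
  finite-by-F (n , r , _ , classes) = rows-finite lem r (rows-covered r classes)

  finite-by-G : FinClassesG D s₀ → FiniteComplexAlgebra D s₀
  finite-by-G (n , r , _ , classes) = columns-finite lem r (columns-covered r classes)

corollary6p9 : ExcludedMiddle 0ℓ →
    (Sg : Signature) (At : Set) (D : LE.Calc Sg At) (x : LE.Str Sg At 𝔽) (y : LE.Str Sg At 𝔾) →
    (LE.FinClassesF Sg At D (LE._⇒_ x y) → LE.FiniteComplexAlgebra Sg At D (LE._⇒_ x y))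
    × (LE.FinClassesG Sg At D (LE._⇒_ x y) → LE.FiniteComplexAlgebra Sg At D (LE._⇒_ x y))
corollary6p9 lem Sg At D x y = finite-by-F , finite-by-G
  where open CanonicalFrame lem Sg At D (LE._⇒_ x y)
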